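{- Let $\epsilon>0$ and let $\mathcal{I}$ be an MBPMD instance with at least $4$ requests such that the union of the perfect matching $A$ produced by $\mathrm{ALG\text{ - }B}(\epsilon)$ and an optimal perfect matching $O$ forms a single cycle (alternating between edges of $A$ and $O$). Let $\{a,b\}$ and $\{c,d\}$ be the last two pairs matched by the algorithm, and name $c,d$ so that, traversing the cycle starting with the edge $\{a,b\}$ from $a$ to $b$ and continuing away from $a$, the endpoint $d$ is reached before $c$ (so the cycle consists of the edge $\{a,b\}$, an alternating path $P_{db}$ from $b$ to $d$, the edge $\{d,c\}$, and an alternating path $P_{ca}$ from $c$ back to $a$, both paths starting and ending with edges of $O$). Then $\mathrm{class}(a)=\mathrm{class}(d)\ne\mathrm{class}(b)=\mathrm{class}(c)$.
   Context: MBPMD: a metric space $(S,d)$; each request $r$ has location $x(r)\in S$, arrival time $t(r)\in\mathbb{R}$, and class $\mathrm{class}(r)\in\{1,2\}$; a valid perfect matching pairs requests of different classes only. An optimal matching is one of minimum total cost $\sum_{\{p,q\}}D(p,q)$ with $D(p,q)=d(x(p),x(q))+|t(p)-t(q)|$. The union of two perfect matchings is considered as a multigraph (two parallel edges count as a cycle). Algorithm $\mathrm{ALG\text{ - }B}(\epsilon)$, $\epsilon>0$: at every moment $t$, for every ordered pair of distinct currently unmatched (already arrived) requests $p,q$ with $t(p)\ge t(q)$ and $\mathrm{class}(p)\ne\mathrm{class}(q)$, if $t=t(p)+D(p,q)/\epsilon$ then $p,q$ are matched at time $t$. Ties are broken arbitrarily. -}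

module Defs where

open import Data.Nat as ℕ using (ℕ; zero; suc)
open import Data.Nat.DivMod using (_mod_)
open import Data.Fin using (Fin; toℕ)
open import Data.Sum using (_⊎_)
open import Data.Product using (_×_)
open import Relation.Nullary using (¬_)
open import Relation.Binary.PropositionalEquality using (_≡_)
open import Relation.Binary.Core using (Rel)
open import Relation.Binary.Definitions using (tri<; tri≈; tri>)
open import Relation.Binary.Structures using (IsStrictTotalOrder)
open import Algebra.Structures using (IsCommutativeRing)

-- Ordered fields (the paper works over ℝ; we state the result for an
-- arbitrary ordered field, of which ℝ is an instance).

record OrderedField : Set₁ where
  infixl 6 _+_ _-_
  infixl 7 _*_
  infix  8 -_ _⁻¹
  infix  4 _<_ _≤_
  field
    Carrier : Set
    _+_ _*_ : Carrier → Carrier → Carrier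
    -_      : Carrier → Carrier
    0# 1#   : Carrier
    _⁻¹     : Carrier → Carrier
    _<_     : Rel Carrier _
    isCommutativeRing  : IsCommutativeRing _≡_ _+_ _*_ -_ 0# 1#
    isStrictTotalOrder : IsStrictTotalOrder _≡_ _<_
    0<1     : 0# < 1#
    ⁻¹-inverse : ∀ x → ¬ (x ≡ 0#) → x * (x ⁻¹) ≡ 1#
    +-mono-< : ∀ {x y} z → x < y → x + z < y + z
    *-pos    : ∀ {x y} → 0# < x → 0# < y → 0# < x * y

  _-_ : Carrier → Carrier → Carrier
  x - y = x + (- y)

  _≤_ : Carrier → Carrier → Set
  x ≤ y = (x < y) ⊎ (x ≡ y)

  open IsStrictTotalOrder isStrictTotalOrder using (compare)

  max : Carrier → Carrier → Carrier
  max x y with compare x y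
  ... | tri< _ _ _ = y
  ... | tri≈ _ _ _ = x
  ... | tri> _ _ _ = x

  ∣_∣ : Carrier → Carrier
  ∣ x ∣ = max x (- x)

  _/_ : Carrier → Carrier → Carrier
  x / y = x * (y ⁻¹)

  sumFin : ∀ {n} → (Fin n → Carrier) → Carrier
  sumFin {zero}  f = 0#
  sumFin {suc n} f = f Fin.zero + sumFin (λ i → f (Fin.suc i))

record MetricSpace (F : OrderedField) : Set₁ where
  open OrderedField F
  field
    Point   : Set
    dist    : Point → Point → Carrier
    dist-self  : ∀ x → dist x x ≡ 0#
    dist-zero  : ∀ x y → dist x y ≡ 0# → x ≡ y
    dist-nonneg : ∀ x y → 0# ≤ dist x y
    dist-sym   : ∀ x y → dist x y ≡ dist y x
    dist-tri   : ∀ x y z → dist x z ≤ dist x y + dist y z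

data Class : Set where
  class1 class2 : Class

record Instance (F : OrderedField) (M : MetricSpace F) (n : ℕ) : Set where
  open OrderedField F
  open MetricSpace M
  field
    loc   : Fin n → Point
    time  : Fin n → Carrier
    cls   : Fin n → Class

module _ {F : OrderedField} {M : MetricSpace F} {n : ℕ} (I : Instance F M n) where
  open OrderedField F
  open MetricSpace M
  open Instance I

  D : Fin n → Fin n → Carrier
  D p q = dist (loc p) (loc q) + ∣ time p - time q ∣

  record IsPerfectMatching (m : Fin n → Fin n) : Set where
    field
      involutive : ∀ i → m (m i) ≡ i
      no-fixed   : ∀ i → ¬ (m i ≡ i)
      bipartite  : ∀ i → ¬ (cls (m i) ≡ cls i)

  -- total cost: sum over the edges {i, m i} (each counted once, from its
  -- endpoint with smaller index)
  cost : (Fin n → Fin n) → Carrier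
  cost m = sumFin (λ i → edgeCost i)
    where
    edgeCost : Fin n → Carrier
    edgeCost i with toℕ i ℕ.<? toℕ (m i)
    ... | Relation.Nullary.yes _ = D i (m i)
    ... | Relation.Nullary.no  _ = 0#

  IsOptimal : (Fin n → Fin n) → Set
  IsOptimal o = IsPerfectMatching o ×
    (∀ m → IsPerfectMatching m → cost o ≤ cost m)

  -- ALG-B(ε): the pair {p,q} (t(p) ≥ t(q)) is matched at time
  -- t(p) + D(p,q)/ε, i.e. max(t(p),t(q)) + D(p,q)/ε.
  trigger : Carrier → Fin n → Fin n → Carrier
  trigger ε p q = max (time p) (time q) + D p q / ε

  matchTime : Carrier → (Fin n → Fin n) → Fin n → Carrier
  matchTime ε a i = trigger ε i (a i)

  -- a is a possible output of ALG-B(ε) (for some tie-breaking): a is a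
  -- perfect matching, every pair of a is matched at its trigger time, and
  -- no pair {p,q} of different classes reaches its trigger time while
  -- both p and q are still unmatched (at that moment at least one of them
  -- has been matched, possibly simultaneously by a tie-break).
  IsALGBOutput : Carrier → (Fin n → Fin n) → Set
  IsALGBOutput ε a = IsPerfectMatching a ×
    (∀ p q → ¬ (cls p ≡ cls q) → ¬ (a p ≡ q) →
       (matchTime ε a p ≤ trigger ε p q) ⊎ (matchTime ε a q ≤ trigger ε p q))

  next : Fin n → Fin n
  next i = go n i
    where
    go : (k : ℕ) → Fin k → Fin k
    go (suc k) j = suc (toℕ j) mod (suc k)

  -- σ enumerates all requests along a single cycle of A ∪ O, alternating
  -- A-edges (from even positions) and O-edges (from odd positions):
  -- σ 0 –A– σ 1 –O– σ 2 –A– … –O– σ 0.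
  IsAlternatingCycle : (Fin n → Fin n) → (Fin n → Fin n) → (Fin n → Fin n) → Set
  IsAlternatingCycle a o σ =
    (∀ i j → σ i ≡ σ j → i ≡ j) ×
    (∀ i → toℕ i ℕ.% 2 ≡ 0 → a (σ i) ≡ σ (next i)) ×
    (∀ i → toℕ i ℕ.% 2 ≡ 1 → o (σ i) ≡ σ (next i))

module Submission where

open import Defs
open import Data.Nat using (ℕ; _≤_)
open import Data.Nat using (_%_)
open import Data.Fin using (Fin; toℕ)
open import Data.Product using (_×_)
open import Relation.Nullary using (¬_)
open import Relation.Binary.PropositionalEquality using (_≡_)

open import Data.Nat using (zero; suc; _<_)
open import Data.Nat.DivMod using (m%n<n; m<n⇒m%n≡m)
open import Data.Fin using (fromℕ<)
open import Data.Fin.Properties using (toℕ<n; toℕ-fromℕ<; fromℕ<-toℕ; toℕ-injective)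
open import Data.Nat.Properties using (<-trans; n<1+n)
open import Data.Product using (_,_; proj₁; proj₂)
open import Data.Sum using (_⊎_; inj₁; inj₂)
open import Function using (_∘_)
open import Relation.Binary.PropositionalEquality using (refl; sym; trans; cong; subst; _≢_; module ≡-Reasoning)
open ≡-Reasoning

-- Classes alternate along the cycle, since every edge of A and of O joins
-- requests of different classes.  So σ i has the class of a = σ 0 exactly
-- when i is even; as d sits at the even position j, class(d) = class(a), and
-- b, c, the A-partners of a, d, have the other class.

other : Class → Class
other class1 = class2
other class2 = class1

other-involutive : ∀ x → other (other x) ≡ x
other-involutive class1 = refl
other-involutive class2 = refl

≢⇒≡other : ∀ {x y} → x ≢ y → y ≡ other x
≢⇒≡other {class1} {class1} x≢y with () ← x≢y refl
≢⇒≡other {class1} {class2} _ = refl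
≢⇒≡other {class2} {class1} _ = refl
≢⇒≡other {class2} {class2} x≢y with () ← x≢y refl

≢-same⇒≡ : ∀ {x y z} → x ≢ z → y ≢ z → x ≡ y
≢-same⇒≡ x≢z y≢z = trans (≢⇒≡other (x≢z ∘ sym)) (sym (≢⇒≡other (y≢z ∘ sym)))

alternate : ℕ → Class → Class
alternate zero    x = x
alternate (suc k) x = other (alternate k x)

alternate-even : ∀ k x → k % 2 ≡ 0 → alternate k x ≡ x
alternate-even zero          x _    = refl
alternate-even (suc zero)    x ()
alternate-even (suc (suc k)) x even =
  trans (other-involutive (alternate k x)) (alternate-even k x even)

%2-cases : ∀ k → k % 2 ≡ 0 ⊎ k % 2 ≡ 1
%2-cases zero          = inj₁ refl
%2-cases (suc zero)    = inj₂ refl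
%2-cases (suc (suc k)) = %2-cases k

toℕ-next : ∀ {F M n} (I : Instance F M n) (p : Fin n) →
            suc (toℕ p) < n → toℕ (next I p) ≡ suc (toℕ p)
toℕ-next {n = suc m} I p p+1<n =
  trans (toℕ-fromℕ< (m%n<n (suc (toℕ p)) (suc m))) (m<n⇒m%n≡m p+1<n)

module _ {F : OrderedField} {M : MetricSpace F} {n : ℕ} (I : Instance F M n) where
  open Instance I

  matching-cls-≢ : ∀ {m} → IsPerfectMatching I m → ∀ {p q} → m p ≡ q → cls q ≢ cls p
  matching-cls-≢ pm {p} refl = IsPerfectMatching.bipartite pm p

  module _ {A O σ : Fin n → Fin n} (pA : IsPerfectMatching I A) (pO : IsPerfectMatching I O)
           (cycle : IsAlternatingCycle I A O σ) where

    cls-next-≢ : ∀ p → cls (σ (next I p)) ≢ cls (σ p)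
    cls-next-≢ p with %2-cases (toℕ p)
    ... | inj₁ even = matching-cls-≢ pA (proj₁ (proj₂ cycle) p even)
    ... | inj₂ odd  = matching-cls-≢ pO (proj₂ (proj₂ cycle) p odd)

    module _ (i₀ : Fin n) (i₀≡0 : toℕ i₀ ≡ 0) where

      cls-σ-fromℕ< : ∀ k (k<n : k < n) → cls (σ (fromℕ< k<n)) ≡ alternate k (cls (σ i₀))
      cls-σ-fromℕ< zero    0<n = cong (cls ∘ σ) (toℕ-injective (trans (toℕ-fromℕ< 0<n) (sym i₀≡0)))
      cls-σ-fromℕ< (suc k) k+1<n = begin
        cls (σ (fromℕ< k+1<n))   ≡⟨ cong (cls ∘ σ) fromℕ<-suc ⟩
        cls (σ (next I p))       ≡⟨ ≢⇒≡other (cls-next-≢ p ∘ sym) ⟩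
        other (cls (σ p))        ≡⟨ cong other (cls-σ-fromℕ< k k<n) ⟩
        alternate (suc k) (cls (σ i₀)) ∎
        where
        k<n : k < n
        k<n = <-trans (n<1+n k) k+1<n
        p : Fin n
        p = fromℕ< k<n
        fromℕ<-suc : fromℕ< k+1<n ≡ next I p
        fromℕ<-suc = toℕ-injective (begin
          toℕ (fromℕ< k+1<n)  ≡⟨ toℕ-fromℕ< k+1<n ⟩
          suc k               ≡⟨ cong suc (toℕ-fromℕ< k<n) ⟨
          suc (toℕ p)         ≡⟨ toℕ-next I p (subst (λ t → suc t < n) (sym (toℕ-fromℕ< k<n)) k+1<n) ⟨
          toℕ (next I p)      ∎)

      cls-σ-even : ∀ j → toℕ j % 2 ≡ 0 → cls (σ j) ≡ cls (σ i₀)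
      cls-σ-even j even = begin
        cls (σ j)                         ≡⟨ cong (cls ∘ σ) (fromℕ<-toℕ j (toℕ<n j)) ⟨
        cls (σ (fromℕ< (toℕ<n j)))        ≡⟨ cls-σ-fromℕ< (toℕ j) (toℕ<n j) ⟩
        alternate (toℕ j) (cls (σ i₀))    ≡⟨ alternate-even (toℕ j) _ even ⟩
        cls (σ i₀)                        ∎

lemma13 : (F : OrderedField) (M : MetricSpace F) (n : ℕ) (I : Instance F M n) →
    (ε : OrderedField.Carrier F) → OrderedField._<_ F (OrderedField.0# F) ε →
    4 ≤ n →
    (A O : Fin n → Fin n) → IsALGBOutput I ε A → IsOptimal I O →
    (σ : Fin n → Fin n) → IsAlternatingCycle I A O σ →
    (i₀ j : Fin n) → toℕ i₀ ≡ 0 → toℕ j % 2 ≡ 0 →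
    (a b c d : Fin n) →
    a ≡ σ i₀ → b ≡ σ (next I i₀) → d ≡ σ j → c ≡ σ (next I j) →
    ¬ (d ≡ a) →
    OrderedField._≤_ F (trigger I ε c d) (trigger I ε a b) →
    (∀ v → ¬ (v ≡ a) → ¬ (v ≡ b) → ¬ (v ≡ c) → ¬ (v ≡ d) →
    OrderedField._≤_ F (matchTime I ε A v) (trigger I ε c d)) →
    (Instance.cls I a ≡ Instance.cls I d) × ¬ (Instance.cls I d ≡ Instance.cls I b) ×
    (Instance.cls I b ≡ Instance.cls I c)
lemma13 F M n I ε _ _ A O (pA , _) (pO , _) σ cycle i₀ j i₀≡0 j-even
        a b c d refl refl refl refl _ _ _ =
  a≡d , (b≢a ∘ sym ∘ trans a≡d) , ≢-same⇒≡ b≢a c≢a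
  where
  open Instance I
  a≡d : cls a ≡ cls d
  a≡d = sym (cls-σ-even I pA pO cycle i₀ i₀≡0 j j-even)
  b≢a : cls b ≢ cls a
  b≢a = cls-next-≢ I pA pO cycle i₀
  c≢a : cls c ≢ cls a
  c≢a = subst (cls c ≢_) (sym a≡d) (cls-next-≢ I pA pO cycle j)
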